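{- The quotient set $X/{\sim}$ is finite.
   Context: IntGC is the logic over intuitionistic propositional logic with additional unary connectives $\vartriangle$, $\triangledown$, closed under substitution, modus ponens and the rules: $A \to \triangledown B$ provable iff $\vartriangle A \to B$ provable. A Kripke model $(X,\le,R,v)$ has $\le$ a preorder, $R$ a relation with $({\ge}\circ R\circ{\ge})\subseteq R$, intuitionistic satisfaction for $\neg,\to,\vee,\wedge$, and $x \models \vartriangle A$ iff some $y$ has $x\,R\,y$ and $y\models A$; $x\models \triangledown A$ iff every $y$ with $y\,R\,x$ satisfies $A$. Fix a formula $A$ and such a model. Let $\Gamma = \mathrm{Sub}(A) \cup \{ \triangledown \vartriangle B \mid \vartriangle B \in \mathrm{Sub}(A) \} \cup \{ \vartriangle \triangledown B \mid \triangledown B \in \mathrm{Sub}(A) \}$ and $\Sigma = \mathrm{Sub}(A) \cup \{ (\triangledown \vartriangle)^n \triangledown B , \vartriangle (\triangledown \vartriangle)^n \triangledown B \mid n \geq 0, \triangledown B \in \Gamma \} \cup \{ (\vartriangle \triangledown)^n \vartriangle B , \triangledown (\vartriangle \triangledown)^n \vartriangle B \mid n \geq 0, \vartriangle B \in \Gamma \}$. Define $x \sim y$ iff for every $B \in \Sigma$, $x \models B$ iff $y \models B$. -}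

module Defs where

open import Data.Nat using (ℕ; zero; suc)
open import Data.Product using (Σ; _×_; ∃-syntax)
open import Data.Sum using (_⊎_)
open import Relation.Nullary using (¬_)
open import Relation.Binary.PropositionalEquality using (_≡_)
open import Function.Bundles using (_⇔_)

infixr 5 _⇒_
infixr 6 _∨_
infixr 7 _∧_

data Form : Set where
  var  : ℕ → Form
  ¬'   : Form → Form
  _∧_  : Form → Form → Form
  _∨_  : Form → Form → Form
  _⇒_  : Form → Form → Form
  △    : Form → Form
  ▽    : Form → Form

record KripkeModel : Set₁ where
  field
    X      : Set
    _≤_    : X → X → Set
    ≤-refl  : ∀ {x} → x ≤ x
    ≤-trans : ∀ {x y z} → x ≤ y → y ≤ z → x ≤ z
    R      : X → X → Set
    R-compat : ∀ {x x' y' y} → x' ≤ x → R x' y' → y ≤ y' → R x y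
    v      : ℕ → X → Set
    v-mono : ∀ {p x y} → x ≤ y → v p x → v p y

module _ (M : KripkeModel) where
  open KripkeModel M

  infix 4 _⊨_
  _⊨_ : X → Form → Set
  x ⊨ var p   = v p x
  x ⊨ ¬' A    = ∀ y → x ≤ y → ¬ (y ⊨ A)
  x ⊨ A ∧ B   = (x ⊨ A) × (x ⊨ B)
  x ⊨ A ∨ B   = (x ⊨ A) ⊎ (x ⊨ B)
  x ⊨ A ⇒ B   = ∀ y → x ≤ y → y ⊨ A → y ⊨ B
  x ⊨ △ A     = ∃[ y ] (R x y × (y ⊨ A))
  x ⊨ ▽ A     = ∀ y → R y x → y ⊨ A

data _∈Sub_ : Form → Form → Set where
  here  : ∀ {A} → A ∈Sub A
  ¬-in  : ∀ {B A} → B ∈Sub A → B ∈Sub ¬' A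
  ∧-inl : ∀ {B A C} → B ∈Sub A → B ∈Sub (A ∧ C)
  ∧-inr : ∀ {B A C} → B ∈Sub C → B ∈Sub (A ∧ C)
  ∨-inl : ∀ {B A C} → B ∈Sub A → B ∈Sub (A ∨ C)
  ∨-inr : ∀ {B A C} → B ∈Sub C → B ∈Sub (A ∨ C)
  ⇒-inl : ∀ {B A C} → B ∈Sub A → B ∈Sub (A ⇒ C)
  ⇒-inr : ∀ {B A C} → B ∈Sub C → B ∈Sub (A ⇒ C)
  △-in  : ∀ {B A} → B ∈Sub A → B ∈Sub △ A
  ▽-in  : ∀ {B A} → B ∈Sub A → B ∈Sub ▽ A

▽△^ : ℕ → Form → Form
▽△^ zero    C = C
▽△^ (suc n) C = ▽ (△ (▽△^ n C))

△▽^ : ℕ → Form → Form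
△▽^ zero    C = C
△▽^ (suc n) C = △ (▽ (△▽^ n C))

data InΓ (A : Form) : Form → Set where
  sub : ∀ {B} → B ∈Sub A → InΓ A B
  ▽△  : ∀ {B} → △ B ∈Sub A → InΓ A (▽ (△ B))
  △▽  : ∀ {B} → ▽ B ∈Sub A → InΓ A (△ (▽ B))

data InΣ (A : Form) : Form → Set where
  sub  : ∀ {B} → B ∈Sub A → InΣ A B
  ▽-a  : ∀ n {B} → InΓ A (▽ B) → InΣ A (▽△^ n (▽ B))
  ▽-b  : ∀ n {B} → InΓ A (▽ B) → InΣ A (△ (▽△^ n (▽ B)))
  △-a  : ∀ n {B} → InΓ A (△ B) → InΣ A (△▽^ n (△ B))
  △-b  : ∀ n {B} → InΓ A (△ B) → InΣ A (▽ (△▽^ n (△ B)))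

Equiv : (M : KripkeModel) (A : Form) → KripkeModel.X M → KripkeModel.X M → Set
Equiv M A x y = ∀ B → InΣ A B → (_⊨_ M x B ⇔ _⊨_ M y B)

-- Over any Kripke model, △ and ▽ form a Galois connection, so ▽△▽B is equivalent
-- to ▽B and △▽△B to △B. Hence every formula of Σ is semantically equivalent to
-- one of the finitely many formulas of Γ, and ∼ is the kernel of the map sending
-- a world to the truth values (decided by excluded middle) of the Γ-formulas.

module Submission where

open import Defs
open import Data.Nat using (ℕ; zero; suc; _^_)
open import Data.Fin using (Fin; #_; combine)
open import Data.Fin.Properties using (combine-injectiveˡ; combine-injectiveʳ)
open import Data.Product using (Σ-syntax; ∃-syntax; _×_; _,_)
open import Data.Sum using (inj₁; inj₂)
open import Data.List using (List; []; _∷_; _++_; concatMap; length)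
open import Data.List.Relation.Unary.Any using (here; there)
open import Data.List.Membership.Propositional using (_∈_; find; lose)
open import Data.List.Membership.Propositional.Properties
  using (∈-++⁺ˡ; ∈-++⁺ʳ; ∈-++⁻; ∈-concatMap⁺; ∈-concatMap⁻)
open import Data.Empty using (⊥-elim)
open import Relation.Nullary using (Dec; yes; no)
open import Relation.Binary.PropositionalEquality using (_≡_; refl; cong₂)
open import Function.Bundles using (_⇔_; mk⇔; Equivalence)
open import Function.Construct.Identity using (⇔-id)
open import Function.Construct.Symmetry using (⇔-sym)
open import Function.Construct.Composition using (_⇔-∘_)
open import Axiom.ExcludedMiddle using (ExcludedMiddle)
open import Level using (0ℓ)

open Equivalence using (to; from)

module _ (lem : ExcludedMiddle 0ℓ) {X T : Set} (test : T → X → Set) where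

  truthValue : {P : Set} → Dec P → Fin 2
  truthValue (yes _) = # 1
  truthValue (no _)  = # 0

  truthValue-≡⇔ : {P Q : Set} (p : Dec P) (q : Dec Q) →
    (truthValue p ≡ truthValue q) ⇔ (P ⇔ Q)
  truthValue-≡⇔ (yes p) (yes q) = mk⇔ (λ _ → mk⇔ (λ _ → q) (λ _ → p)) (λ _ → refl)
  truthValue-≡⇔ (no ¬p) (no ¬q) =
    mk⇔ (λ _ → mk⇔ (λ p → ⊥-elim (¬p p)) (λ q → ⊥-elim (¬q q))) (λ _ → refl)
  truthValue-≡⇔ (yes p) (no ¬q) = mk⇔ (λ ()) (λ P⇔Q → ⊥-elim (¬q (to P⇔Q p)))
  truthValue-≡⇔ (no ¬p) (yes q) = mk⇔ (λ ()) (λ P⇔Q → ⊥-elim (¬p (from P⇔Q q)))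

  profile : (ts : List T) → X → Fin (2 ^ length ts)
  profile []       x = # 0
  profile (t ∷ ts) x = combine (truthValue (lem {test t x})) (profile ts x)

  profile-≡⇔ : ∀ ts x y →
    (profile ts x ≡ profile ts y) ⇔ (∀ {t} → t ∈ ts → test t x ⇔ test t y)
  profile-≡⇔ []       x y = mk⇔ (λ _ ()) (λ _ → refl)
  profile-≡⇔ (t ∷ ts) x y = mk⇔ agree same
    where
    bit : X → Fin 2
    bit z = truthValue (lem {test t z})

    head-≡⇔ : (bit x ≡ bit y) ⇔ (test t x ⇔ test t y)
    head-≡⇔ = truthValue-≡⇔ lem lem

    Agree : Set
    Agree = ∀ {s} → s ∈ t ∷ ts → test s x ⇔ test s y

    agree : profile (t ∷ ts) x ≡ profile (t ∷ ts) y → Agree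
    agree eq (here refl) = to head-≡⇔ (combine-injectiveˡ _ _ _ _ eq)
    agree eq (there s∈)  = to (profile-≡⇔ ts x y)
      (combine-injectiveʳ (bit x) (profile ts x) (bit y) (profile ts y) eq) s∈

    same : Agree → profile (t ∷ ts) x ≡ profile (t ∷ ts) y
    same h = cong₂ combine (from head-≡⇔ (h (here refl)))
                           (from (profile-≡⇔ ts x y) (λ s∈ → h (there s∈)))

subformulas : Form → List Form
properSubformulas : Form → List Form

subformulas A = A ∷ properSubformulas A

properSubformulas (var _) = []
properSubformulas (¬' A)  = subformulas A
properSubformulas (A ∧ B) = subformulas A ++ subformulas B
properSubformulas (A ∨ B) = subformulas A ++ subformulas B
properSubformulas (A ⇒ B) = subformulas A ++ subformulas B
properSubformulas (△ A)   = subformulas A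
properSubformulas (▽ A)   = subformulas A

∈Sub⇒∈subformulas : ∀ {A B} → B ∈Sub A → B ∈ subformulas A
∈Sub⇒∈subformulas here      = here refl
∈Sub⇒∈subformulas (¬-in p)  = there (∈Sub⇒∈subformulas p)
∈Sub⇒∈subformulas (∧-inl p) = there (∈-++⁺ˡ (∈Sub⇒∈subformulas p))
∈Sub⇒∈subformulas (∧-inr {A = L} p) = there (∈-++⁺ʳ (subformulas L) (∈Sub⇒∈subformulas p))
∈Sub⇒∈subformulas (∨-inl p) = there (∈-++⁺ˡ (∈Sub⇒∈subformulas p))
∈Sub⇒∈subformulas (∨-inr {A = L} p) = there (∈-++⁺ʳ (subformulas L) (∈Sub⇒∈subformulas p))
∈Sub⇒∈subformulas (⇒-inl p) = there (∈-++⁺ˡ (∈Sub⇒∈subformulas p))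
∈Sub⇒∈subformulas (⇒-inr {A = L} p) = there (∈-++⁺ʳ (subformulas L) (∈Sub⇒∈subformulas p))
∈Sub⇒∈subformulas (△-in p)  = there (∈Sub⇒∈subformulas p)
∈Sub⇒∈subformulas (▽-in p)  = there (∈Sub⇒∈subformulas p)

∈subformulas⇒∈Sub : ∀ A {B} → B ∈ subformulas A → B ∈Sub A
∈subformulas⇒∈Sub A (here refl) = here
∈subformulas⇒∈Sub (¬' A) (there p) = ¬-in (∈subformulas⇒∈Sub A p)
∈subformulas⇒∈Sub (A ∧ C) (there p) with ∈-++⁻ (subformulas A) p
... | inj₁ q = ∧-inl (∈subformulas⇒∈Sub A q)
... | inj₂ q = ∧-inr (∈subformulas⇒∈Sub C q)
∈subformulas⇒∈Sub (A ∨ C) (there p) with ∈-++⁻ (subformulas A) p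
... | inj₁ q = ∨-inl (∈subformulas⇒∈Sub A q)
... | inj₂ q = ∨-inr (∈subformulas⇒∈Sub C q)
∈subformulas⇒∈Sub (A ⇒ C) (there p) with ∈-++⁻ (subformulas A) p
... | inj₁ q = ⇒-inl (∈subformulas⇒∈Sub A q)
... | inj₂ q = ⇒-inr (∈subformulas⇒∈Sub C q)
∈subformulas⇒∈Sub (△ A) (there p) = △-in (∈subformulas⇒∈Sub A p)
∈subformulas⇒∈Sub (▽ A) (there p) = ▽-in (∈subformulas⇒∈Sub A p)

modalSwaps : Form → List Form
modalSwaps (△ B) = ▽ (△ B) ∷ []
modalSwaps (▽ B) = △ (▽ B) ∷ []
modalSwaps _     = []

Γ-list : Form → List Form
Γ-list A = subformulas A ++ concatMap modalSwaps (subformulas A)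

∈modalSwaps⇒InΓ : ∀ {A C} D → D ∈Sub A → C ∈ modalSwaps D → InΓ A C
∈modalSwaps⇒InΓ (△ B) p (here refl) = ▽△ p
∈modalSwaps⇒InΓ (▽ B) p (here refl) = △▽ p
∈modalSwaps⇒InΓ (△ B) p (there ())
∈modalSwaps⇒InΓ (▽ B) p (there ())
∈modalSwaps⇒InΓ (var _) p ()
∈modalSwaps⇒InΓ (¬' _)  p ()
∈modalSwaps⇒InΓ (_ ∧ _) p ()
∈modalSwaps⇒InΓ (_ ∨ _) p ()
∈modalSwaps⇒InΓ (_ ⇒ _) p ()

InΓ⇒∈Γ-list : ∀ {A C} → InΓ A C → C ∈ Γ-list A
InΓ⇒∈Γ-list     (sub p) = ∈-++⁺ˡ (∈Sub⇒∈subformulas p)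
InΓ⇒∈Γ-list {A} (▽△ p) =
  ∈-++⁺ʳ (subformulas A) (∈-concatMap⁺ modalSwaps (lose (∈Sub⇒∈subformulas p) (here refl)))
InΓ⇒∈Γ-list {A} (△▽ p) =
  ∈-++⁺ʳ (subformulas A) (∈-concatMap⁺ modalSwaps (lose (∈Sub⇒∈subformulas p) (here refl)))

∈Γ-list⇒InΓ : ∀ A {C} → C ∈ Γ-list A → InΓ A C
∈Γ-list⇒InΓ A C∈ with ∈-++⁻ (subformulas A) C∈
... | inj₁ p = sub (∈subformulas⇒∈Sub A p)
... | inj₂ q with find (∈-concatMap⁻ modalSwaps q)
...   | D , D∈ , C∈swaps = ∈modalSwaps⇒InΓ D (∈subformulas⇒∈Sub A D∈) C∈swaps

InΓ⇒InΣ : ∀ {A C} → InΓ A C → InΣ A C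
InΓ⇒InΣ (sub p) = sub p
InΓ⇒InΣ (▽△ p)  = ▽-a 0 (▽△ p)
InΓ⇒InΣ (△▽ p)  = △-a 0 (△▽ p)

module _ (M : KripkeModel) where
  open KripkeModel M using (X)

  infix 4 _⊨ᴹ_ _≋_
  _⊨ᴹ_ : X → Form → Set
  x ⊨ᴹ B = _⊨_ M x B

  record _≋_ (B C : Form) : Set where
    constructor mk≋
    field ⇔-at : ∀ x → x ⊨ᴹ B ⇔ x ⊨ᴹ C
  open _≋_

  ≋-refl : ∀ {B} → B ≋ B
  ≋-refl {B} = mk≋ λ x → ⇔-id (x ⊨ᴹ B)

  ≋-trans : ∀ {B C D} → B ≋ C → C ≋ D → B ≋ D
  ≋-trans B≋C C≋D = mk≋ λ x → ⇔-at C≋D x ⇔-∘ ⇔-at B≋C x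

  △-cong : ∀ {B C} → B ≋ C → △ B ≋ △ C
  △-cong B≋C = mk≋ λ x → mk⇔
    (λ (y , xRy , y⊨B) → y , xRy , to (⇔-at B≋C y) y⊨B)
    (λ (y , xRy , y⊨C) → y , xRy , from (⇔-at B≋C y) y⊨C)

  ▽-cong : ∀ {B C} → B ≋ C → ▽ B ≋ ▽ C
  ▽-cong B≋C = mk≋ λ x → mk⇔
    (λ x⊨▽B y yRx → to (⇔-at B≋C y) (x⊨▽B y yRx))
    (λ x⊨▽C y yRx → from (⇔-at B≋C y) (x⊨▽C y yRx))

  ▽△▽≋▽ : ∀ B → ▽ (△ (▽ B)) ≋ ▽ B
  ▽△▽≋▽ B = mk≋ λ x → mk⇔ (collapse x) (λ x⊨▽B y yRx → x , yRx , x⊨▽B)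
    where
    collapse : ∀ x → x ⊨ᴹ ▽ (△ (▽ B)) → x ⊨ᴹ ▽ B
    collapse x x⊨▽△▽B y yRx with x⊨▽△▽B y yRx
    ... | z , yRz , z⊨▽B = z⊨▽B y yRz

  △▽△≋△ : ∀ B → △ (▽ (△ B)) ≋ △ B
  △▽△≋△ B = mk≋ λ x → mk⇔
    (λ (y , xRy , y⊨▽△B) → y⊨▽△B x xRy)
    (λ (y , xRy , y⊨B) → y , xRy , λ z zRy → y , zRy , y⊨B)

  ▽△^-▽≋▽ : ∀ n B → ▽△^ n (▽ B) ≋ ▽ B
  ▽△^-▽≋▽ zero    B = ≋-refl
  ▽△^-▽≋▽ (suc n) B = ≋-trans (▽-cong (△-cong (▽△^-▽≋▽ n B))) (▽△▽≋▽ B)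

  △▽^-△≋△ : ∀ n B → △▽^ n (△ B) ≋ △ B
  △▽^-△≋△ zero    B = ≋-refl
  △▽^-△≋△ (suc n) B = ≋-trans (△-cong (▽-cong (△▽^-△≋△ n B))) (△▽△≋△ B)

  InΣ⇒≋InΓ : ∀ {A B} → InΣ A B → ∃[ C ] (InΓ A C × B ≋ C)
  InΣ⇒≋InΓ (sub p)         = _ , sub p , ≋-refl
  InΣ⇒≋InΓ (▽-a n (sub p)) = _ , sub p , ▽△^-▽≋▽ n _
  InΣ⇒≋InΓ (▽-a n (▽△ p))  = _ , ▽△ p , ▽△^-▽≋▽ n _
  InΣ⇒≋InΓ (▽-b n (sub p)) = _ , △▽ p , △-cong (▽△^-▽≋▽ n _)
  InΣ⇒≋InΓ (▽-b n (▽△ p))  = _ , sub p , ≋-trans (△-cong (▽△^-▽≋▽ n _)) (△▽△≋△ _)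
  InΣ⇒≋InΓ (△-a n (sub p)) = _ , sub p , △▽^-△≋△ n _
  InΣ⇒≋InΓ (△-a n (△▽ p))  = _ , △▽ p , △▽^-△≋△ n _
  InΣ⇒≋InΓ (△-b n (sub p)) = _ , ▽△ p , ▽-cong (△▽^-△≋△ n _)
  InΣ⇒≋InΓ (△-b n (△▽ p))  = _ , sub p , ≋-trans (▽-cong (△▽^-△≋△ n _)) (▽△▽≋▽ _)

  Equiv⇔agree-on-Γ-list : ∀ A x y →
    Equiv M A x y ⇔ (∀ {C} → C ∈ Γ-list A → x ⊨ᴹ C ⇔ y ⊨ᴹ C)
  Equiv⇔agree-on-Γ-list A x y = mk⇔ agree-on-Γ-list agree-on-Σ
    where
    AgreeOnΓ-list : Set
    AgreeOnΓ-list = ∀ {C} → C ∈ Γ-list A → x ⊨ᴹ C ⇔ y ⊨ᴹ C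

    agree-on-Γ-list : Equiv M A x y → AgreeOnΓ-list
    agree-on-Γ-list x∼y C∈ = x∼y _ (InΓ⇒InΣ (∈Γ-list⇒InΓ A C∈))

    agree-on-Σ : AgreeOnΓ-list → Equiv M A x y
    agree-on-Σ agree B B∈Σ =
      let C , C∈Γ , B≋C = InΣ⇒≋InΓ B∈Σ in
      ⇔-sym (⇔-at B≋C y) ⇔-∘ (agree (InΓ⇒∈Γ-list C∈Γ) ⇔-∘ ⇔-at B≋C x)

lemma3p4 : ExcludedMiddle 0ℓ → (A : Form) (M : KripkeModel) →
    Σ[ n ∈ ℕ ] Σ[ f ∈ (KripkeModel.X M → Fin n) ]
    (∀ x y → (f x ≡ f y) ⇔ Equiv M A x y)
lemma3p4 lem A M = _ , profile lem Γ-test (Γ-list A) , λ x y →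
  ⇔-sym (Equiv⇔agree-on-Γ-list M A x y) ⇔-∘ profile-≡⇔ lem Γ-test (Γ-list A) x y
  where
  Γ-test : Form → KripkeModel.X M → Set
  Γ-test C x = _⊨_ M x C
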